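{- Let $n\ge2$ and $\lambda$ a partition with at most $n-1$ non-zero parts. Then $f(\mathcal{A}(\lambda))\subseteq\mathcal{F}(\lambda,n)$. If $\lambda$ has $n-1$ distinct non-zero parts, then $f:\mathcal{A}(\lambda)\to\mathcal{F}(\lambda,n)$ is surjective.
   Context: Permutations in one-line notation; $(a,b)$, $a<b$, denotes a transposition; $wT:=wt_1\cdots t_s$ for $T=(t_1,\dots,t_s)$ (right multiplication by $(a,b)$ swaps the entries in positions $a,b$); Bruhat order on $S_n$ as usual. $\lambda'_j=\#\{i:\lambda_i\ge j\}$. For $1\le k\le n-1$, $\Gamma(k)=((1,n),(1,n-1),\dots,(1,k+1),(2,n),\dots,(2,k+1),\dots,(k,n),\dots,(k,k+1))$; $\Gamma=\Gamma_{\lambda_1}\cdots\Gamma_1$ with $\Gamma_j=\Gamma(\lambda'_j)$. A subsequence $T$ of $\Gamma$ (a choice of positions) splits as $T=T_{\lambda_1}\cdots T_1$ with $T_j$ the entries in $\Gamma_j$. $W_\lambda$ is the stabilizer of $\lambda\in\mathbb{Z}^n$ under permutation of coordinates and $S_n^\lambda$ the minimal-length representatives of cosets $wW_\lambda$. $\mathcal{A}(\lambda)$ is the set of pairs $(w,T)$, $w\in S_n^\lambda$, $T=(t_1,\dots,t_s)$ a subsequence of $\Gamma$, with $w>wt_1>\cdots>wt_1\cdots t_s$ strictly in Bruhat order. Filling map: $\pi_j=wT_{\lambda_1}\cdots T_{j+1}$, $f(w,T)(i,j)=\pi_j(i)$ on the cells $(i,j)$, $1\le j\le\lambda_i$, of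 the Young diagram (column 1 rightmost, columns increasing to the left, rows downward). For $u=(i,j)$, $j\ne1$, $\mathrm{rt}(u)=(i,j-1)$; cells $u,v$ attack if in the same column or $u=(i,j)$, $v=(k,j-1)$ with $i>k$. $\mathcal{F}(\lambda,n)$ is the set of fillings $\sigma$ with values in $[n]$ such that $\sigma(u)\ne\sigma(v)$ for attacking $u,v$ and $\sigma(u)\ge\sigma(\mathrm{rt}(u))$ whenever defined. -}

module Defs where

open import Data.Nat as ℕ using (ℕ; zero; suc; _≤_; _<_)
import Data.Nat.Properties as ℕP
open import Data.Fin as F using (Fin; toℕ)
import Data.Fin.Properties as FP
open import Data.Vec as V using (Vec; lookup; _[_]≔_)
open import Data.List as L using (List; []; _∷_; length; filter; allFin; downFrom; concatMap; reverse)
open import Data.List.Relation.Unary.All using (All)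
open import Data.List.Relation.Unary.Linked using (Linked)
open import Data.Bool using (Bool; true; false)
open import Data.Product using (Σ; ∃; ∃-syntax; _×_; _,_; proj₁; proj₂)
open import Data.Unit using (⊤)
open import Relation.Binary.PropositionalEquality using (_≡_; _≢_)
open import Relation.Binary.Construct.Closure.ReflexiveTransitive using (Star)

-- Conventions: indices of permutations/positions/rows are 0-based (Fin n);
-- paper position/row/value i+1 corresponds to our i.  Columns are 1-based.

IsPartition : List ℕ → Set
IsPartition p = All (1 ≤_) p × Linked ℕ._≥_ p

-- i-th part (0-based), zero beyond the length (the vector λ ∈ ℤ^n padded by zeros).
part : List ℕ → ℕ → ℕ
part []      _       = 0
part (x ∷ p) zero    = x
part (x ∷ p) (suc i) = part p i

firstPart : List ℕ → ℕ
firstPart []      = 0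
firstPart (x ∷ _) = x

conj : List ℕ → ℕ → ℕ
conj p j = length (filter (j ℕ.≤?_) p)

-- permutations in one-line notation: w = (w(0), …, w(n-1))
Word : ℕ → Set
Word n = Vec (Fin n) n

IsPerm : ∀ {n} → Word n → Set
IsPerm {n} w = ∀ (i : Fin n) → ∃[ k ] lookup w k ≡ i

_∘ₚ_ : ∀ {n} → Word n → Word n → Word n
w ∘ₚ v = V.map (lookup w) v

Transp : ℕ → Set
Transp n = Fin n × Fin n

-- right multiplication w·(a,b): swaps entries in positions a, b
_·_ : ∀ {n} → Word n → Transp n → Word n
w · (a , b) = (w [ a ]≔ lookup w b) [ b ]≔ lookup w a

_·*_ : ∀ {n} → Word n → List (Transp n) → Word n
w ·* []       = w
w ·* (t ∷ ts) = (w · t) ·* ts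

-- Coxeter length = number of inversions
len : ∀ {n} → Word n → ℕ
len {n} w = length (filter (λ ij → lookup w (proj₂ ij) F.<? lookup w (proj₁ ij))
                           (filter (λ ij → proj₁ ij F.<? proj₂ ij)
                                   (L.cartesianProduct (allFin n) (allFin n))))

BruhatStep : ∀ {n} → Word n → Word n → Set
BruhatStep {n} u w = Σ (Transp n) λ t → (proj₁ t F.< proj₂ t) × (w ≡ u · t) × (len u < len w)

_≤B_ : ∀ {n} → Word n → Word n → Set
u ≤B w = Star BruhatStep u w

_<B_ : ∀ {n} → Word n → Word n → Set
u <B w = (u ≤B w) × (u ≢ w)

-- stabilizer W_λ of λ (padded to ℤ^n) under permutation of coordinates
InStab : ∀ {n} → List ℕ → Word n → Set
InStab {n} p v = ∀ (i : Fin n) → part p (toℕ (lookup v i)) ≡ part p (toℕ i)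

-- S_n^λ: w is of minimal length in its coset w W_λ
IsMinRep : ∀ {n} → List ℕ → Word n → Set
IsMinRep {n} p w = IsPerm w × (∀ (v : Word n) → IsPerm v → InStab p v → len w ≤ len (w ∘ₚ v))

-- Γ(k) = ((1,n),…,(1,k+1),(2,n),…,(k,n),…,(k,k+1))   (0-based)
Γk : (n k : ℕ) → List (Transp n)
Γk n k = concatMap (λ a → L.map (a ,_) (reverse (filter (λ b → k ℕ.≤? toℕ b) (allFin n))))
                   (filter (λ a → suc (toℕ a) ℕ.≤? k) (allFin n))

-- Γ = Γ_{λ₁} ⋯ Γ₁, each entry tagged with its block index j
Γ : (n : ℕ) → List ℕ → List (ℕ × Transp n)
Γ n p = concatMap (λ j → L.map (suc j ,_) (Γk n (conj p (suc j)))) (downFrom (firstPart p))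

select : ∀ {A : Set} → List A → List Bool → List A
select []       _             = []
select (x ∷ xs) []            = []
select (x ∷ xs) (true  ∷ bs) = x ∷ select xs bs
select (x ∷ xs) (false ∷ bs) = select xs bs

IsMask : ∀ {A : Set} → List A → List Bool → Set
IsMask xs m = length m ≡ length xs

DecChain : ∀ {n} → Word n → List (Transp n) → Set
DecChain w []       = ⊤
DecChain w (t ∷ ts) = ((w · t) <B w) × DecChain (w · t) ts

Tseq : ∀ {n} → List ℕ → List Bool → List (Transp n)
Tseq {n} p m = L.map proj₂ (select (Γ n p) m)

InA : ∀ {n} → List ℕ → Word n → List Bool → Set
InA {n} p w m = IsMinRep p w × IsMask (Γ n p) m × DecChain w (Tseq p m)

-- π_j = w T_{λ₁} ⋯ T_{j+1}
πj : ∀ {n} → List ℕ → Word n → List Bool → ℕ → Word n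
πj {n} p w m j = w ·* L.map proj₂ (filter (λ e → suc j ℕ.≤? proj₁ e) (select (Γ n p) m))

-- fillings: σ i j for row i (0-based), column j (1-based)
Filling : ℕ → Set
Filling n = Fin n → ℕ → Fin n

Cell : ∀ {n} → List ℕ → Fin n → ℕ → Set
Cell p i j = (1 ≤ j) × (j ≤ part p (toℕ i))

fill : ∀ {n} → List ℕ → Word n → List Bool → Filling n
fill p w m i j = lookup (πj p w m j) i

InF : ∀ {n} → List ℕ → Filling n → Set
InF {n} p σ =
  (∀ (i k : Fin n) (j : ℕ) → Cell p i j → Cell p k j → i ≢ k → σ i j ≢ σ k j)
  × (∀ (i k : Fin n) (j : ℕ) → Cell p i (suc j) → Cell p k j → k F.< i → σ i (suc j) ≢ σ k j)
  × (∀ (i : Fin n) (j : ℕ) → 1 ≤ j → Cell p i (suc j) → σ i j F.≤ σ i (suc j))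

module Submission where

-- Inclusion (fill-in-F): along such a decreasing B the entries of the rows
-- i < λ'_{j+1} can only decrease, and no value x(i) lands in a row c < i;
-- columns are injective since the π_j are permutations.
-- Surjectivity (Surjectivity): read Γ backwards from the word whose first n-1
-- entries form the first column of σ, applying (a,b) exactly when it moves
-- σ(a,j) into row a as an ascent (Greedy).  The conditions defining ℱ make each
-- block rebuild the next column, the applied swaps form a decreasing chain, and
-- w is a minimal coset representative since W_λ is trivial for distinct parts.

open import Defs
open import Data.Nat as ℕ using (ℕ; zero; suc; _≤_; _<_; _∸_; z≤n; s≤s)
import Data.Nat.Properties as ℕP
open import Data.Fin as F using (Fin; toℕ)
import Data.Fin.Properties as FP
open import Data.Vec as V using (lookup; _[_]≔_)
import Data.Vec.Properties as VP
open import Data.List as L using (List; []; _∷_; length; filter; allFin; concatMap; reverse; downFrom; _++_)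
import Data.List.Properties as LP
open import Data.List.Membership.Propositional using (_∈_; _∉_; find)
import Data.List.Membership.Propositional.Properties as MP
open import Data.List.Relation.Unary.Any as Any using (Any; here; there)
import Data.List.Relation.Unary.Any.Properties as AnyP
open import Data.List.Relation.Unary.All as All using (All; []; _∷_)
open import Data.List.Relation.Unary.AllPairs using (AllPairs; []; _∷_)
import Data.List.Relation.Unary.AllPairs.Properties as APP
import Data.List.Relation.Unary.All.Properties as AllP
import Data.List.Relation.Unary.Linked.Properties as LkP
open import Data.List.Relation.Unary.Unique.Propositional using (Unique)
import Data.List.Relation.Unary.Unique.Propositional.Properties as UP
open import Data.Bool using (Bool; true; false)
open import Data.Product using (Σ; ∃-syntax; _×_; _,_; proj₁; proj₂)
open import Data.Sum using (inj₁; inj₂)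
open import Data.Empty using (⊥-elim)
open import Data.Unit using (tt)
open import Relation.Nullary using (¬_; Dec; yes; no; does)
open import Relation.Nullary.Decidable using (_×-dec_)
open import Relation.Unary using (Decidable)
open import Relation.Binary using (tri<; tri≈; tri>)
open import Relation.Binary.PropositionalEquality
open import Relation.Binary.Construct.Closure.ReflexiveTransitive using (ε; _◅_)
open import Function.Definitions using (Injective)
open import Data.Fin.Permutation.Components using (transpose)

private variable n : ℕ

word-ext : {u v : Word n} → (∀ i → lookup u i ≡ lookup v i) → u ≡ v
word-ext {u = u} {v} eq = begin
  u                     ≡⟨ VP.tabulate∘lookup u ⟨
  V.tabulate (lookup u) ≡⟨ VP.tabulate-cong eq ⟩
  V.tabulate (lookup v) ≡⟨ VP.tabulate∘lookup v ⟩
  v                     ∎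
  where open ≡-Reasoning

swap-at-fst : (w : Word n) (a b : Fin n) → lookup (w · (a , b)) a ≡ lookup w b
swap-at-fst w a b with a F.≟ b
... | yes refl = VP.lookup∘update a (w [ a ]≔ lookup w a) (lookup w a)
... | no a≢b = trans (VP.lookup∘update′ a≢b (w [ a ]≔ lookup w b) (lookup w a)) (VP.lookup∘update a w _)

swap-at-snd : (w : Word n) (a b : Fin n) → lookup (w · (a , b)) b ≡ lookup w a
swap-at-snd w a b = VP.lookup∘update b (w [ a ]≔ lookup w b) (lookup w a)

swap-elsewhere : (w : Word n) (a b c : Fin n) → c ≢ a → c ≢ b → lookup (w · (a , b)) c ≡ lookup w c
swap-elsewhere w a b c c≢a c≢b =
  trans (VP.lookup∘update′ c≢b (w [ a ]≔ lookup w b) (lookup w a)) (VP.lookup∘update′ c≢a w (lookup w b))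

swap-lookup : (w : Word n) (a b c : Fin n) → lookup (w · (a , b)) c ≡ lookup w (transpose a b c)
swap-lookup w a b c with c F.≟ a
... | yes refl = swap-at-fst w c b
... | no c≢a with c F.≟ b
...   | yes refl = swap-at-snd w a c
...   | no c≢b = swap-elsewhere w a b c c≢a c≢b

transpose-fst : (a b : Fin n) → transpose a b a ≡ b
transpose-fst a b with a F.≟ a
... | yes _ = refl
... | no a≢a = ⊥-elim (a≢a refl)

transpose-snd : (a b : Fin n) → transpose a b b ≡ a
transpose-snd a b with b F.≟ a
... | yes b≡a = b≡a
... | no _ with b F.≟ b
...   | yes _ = refl
...   | no b≢b = ⊥-elim (b≢b refl)

transpose-other : (a b c : Fin n) → c ≢ a → c ≢ b → transpose a b c ≡ c
transpose-other a b c c≢a c≢b with c F.≟ a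
... | yes c≡a = ⊥-elim (c≢a c≡a)
... | no _ with c F.≟ b
...   | yes c≡b = ⊥-elim (c≢b c≡b)
...   | no _ = refl

transpose-involutive : (a b c : Fin n) → transpose a b (transpose a b c) ≡ c
transpose-involutive a b c = by-cases (c F.≟ a) (c F.≟ b)
  where
  by-cases : Dec (c ≡ a) → Dec (c ≡ b) → transpose a b (transpose a b c) ≡ c
  by-cases (yes refl) _ = trans (cong (transpose c b) (transpose-fst c b)) (transpose-snd c b)
  by-cases (no _) (yes refl) = trans (cong (transpose a c) (transpose-snd a c)) (transpose-fst a c)
  by-cases (no c≢a) (no c≢b) =
    trans (cong (transpose a b) (transpose-other a b c c≢a c≢b)) (transpose-other a b c c≢a c≢b)

swap-involutive : (w : Word n) (a b : Fin n) → (w · (a , b)) · (a , b) ≡ w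
swap-involutive w a b = word-ext λ c → begin
  lookup ((w · (a , b)) · (a , b)) c      ≡⟨ swap-lookup (w · (a , b)) a b c ⟩
  lookup (w · (a , b)) (transpose a b c)  ≡⟨ swap-lookup w a b (transpose a b c) ⟩
  lookup w (transpose a b (transpose a b c)) ≡⟨ cong (lookup w) (transpose-involutive a b c) ⟩
  lookup w c                              ∎
  where open ≡-Reasoning

swap-trivial : (w : Word n) (a b : Fin n) → lookup w a ≡ lookup w b → w · (a , b) ≡ w
swap-trivial w a b wa≡wb = word-ext entry
  where
  entry : ∀ c → lookup (w · (a , b)) c ≡ lookup w c
  entry c with c F.≟ b | c F.≟ a
  ... | yes refl | _ = trans (swap-at-snd w a c) wa≡wb
  ... | no _ | yes refl = trans (swap-at-fst w c b) (sym wa≡wb)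
  ... | no c≢b | no c≢a = swap-elsewhere w a b c c≢a c≢b

IsInjective : Word n → Set
IsInjective w = Injective _≡_ _≡_ (lookup w)

swap-injective : (w : Word n) (a b : Fin n) → IsInjective w → IsInjective (w · (a , b))
swap-injective w a b w-inj {i} {j} eq = begin
  i                               ≡⟨ transpose-involutive a b i ⟨
  transpose a b (transpose a b i) ≡⟨ cong (transpose a b) (w-inj τ-eq) ⟩
  transpose a b (transpose a b j) ≡⟨ transpose-involutive a b j ⟩
  j                               ∎
  where
  open ≡-Reasoning
  τ-eq : lookup w (transpose a b i) ≡ lookup w (transpose a b j)
  τ-eq = trans (sym (swap-lookup w a b i)) (trans eq (swap-lookup w a b j))

injective⇒onto : (f : Fin n → Fin n) → Injective _≡_ _≡_ f → ∀ v → ∃[ i ] f i ≡ v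
injective⇒onto {zero} f f-inj ()
injective⇒onto {suc n} f f-inj v with FP.any? (λ i → f i F.≟ v)
... | yes hit = hit
... | no miss = ⊥-elim (ℕP.<-irrefl refl (FP.injective⇒≤ g-inj))
  where
  f≢v : ∀ i → v ≢ f i
  f≢v i eq = miss (i , sym eq)
  g : Fin (suc n) → Fin n
  g i = F.punchOut (f≢v i)
  g-inj : Injective _≡_ _≡_ g
  g-inj {i} {j} eq = f-inj (FP.punchOut-injective (f≢v i) (f≢v j) eq)

injective⇒perm : (w : Word n) → IsInjective w → IsPerm w
injective⇒perm w = injective⇒onto (lookup w)

perm⇒injective : (w : Word n) → IsPerm w → IsInjective w
perm⇒injective w w-perm {i} {j} eq = same-preimage (pre-onto i) (pre-onto j)
  where
  pre : Fin _ → Fin _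
  pre v = proj₁ (w-perm v)
  pre-right : ∀ v → lookup w (pre v) ≡ v
  pre-right v = proj₂ (w-perm v)
  pre-onto : ∀ i → ∃[ v ] pre v ≡ i
  pre-onto = injective⇒onto pre (λ {u} {v} eq → trans (sym (pre-right u)) (trans (cong (lookup w) eq) (pre-right v)))
  same-preimage : ∃[ u ] pre u ≡ i → ∃[ v ] pre v ≡ j → i ≡ j
  same-preimage (u , refl) (v , refl) = cong pre (trans (sym (pre-right u)) (trans eq (pre-right v)))

module _ {A : Set} where

  unique-⊆-length : {xs ys : List A} → Unique xs → (∀ {z} → z ∈ xs → z ∈ ys) → length xs ≤ length ys
  unique-⊆-length {[]} _ _ = z≤n
  unique-⊆-length {x ∷ xs} {ys} (x∉xs ∷ xs-uniq) xs⊆ys with MP.∈-∃++ (xs⊆ys (here refl))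
  ... | us , vs , refl = begin
    suc (length xs)            ≤⟨ s≤s (unique-⊆-length xs-uniq xs⊆us++vs) ⟩
    suc (length (us ++ vs))    ≡⟨ cong suc (LP.length-++ us) ⟩
    suc (length us ℕ.+ length vs) ≡⟨ ℕP.+-suc (length us) (length vs) ⟨
    length us ℕ.+ length (x ∷ vs) ≡⟨ LP.length-++ us ⟨
    length (us ++ x ∷ vs)      ∎
    where
    open ℕP.≤-Reasoning
    xs⊆us++vs : ∀ {z} → z ∈ xs → z ∈ us ++ vs
    xs⊆us++vs {z} z∈xs with MP.∈-++⁻ us (xs⊆ys (there z∈xs))
    ... | inj₁ z∈us = MP.∈-++⁺ˡ z∈us
    ... | inj₂ (here refl) = ⊥-elim (All.lookup x∉xs z∈xs refl)
    ... | inj₂ (there z∈vs) = MP.∈-++⁺ʳ us z∈vs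

  unique-map : (h : A → A) {xs : List A} → (∀ {x y} → x ∈ xs → y ∈ xs → h x ≡ h y → x ≡ y) →
    Unique xs → Unique (L.map h xs)
  unique-map h {[]} _ _ = []
  unique-map h {x ∷ xs} h-inj (x∉xs ∷ xs-uniq) =
    All.tabulate hx∉ ∷ unique-map h (λ x∈ y∈ → h-inj (there x∈) (there y∈)) xs-uniq
    where
    hx∉ : ∀ {z} → z ∈ L.map h xs → h x ≢ z
    hx∉ z∈ hx≡z with MP.∈-map⁻ h z∈
    ... | y , y∈xs , refl = All.lookup x∉xs y∈xs (h-inj (here refl) (there y∈xs) hx≡z)

  involution-count : {P Q : A → Set} (P? : Decidable P) (Q? : Decidable Q) {L : List A} → Unique L →
    (h : A → A) → (∀ {x} → x ∈ L → h (h x) ≡ x) → (∀ {x} → x ∈ L → P x → h x ∈ L × Q (h x)) →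
    (y : A) → y ∈ L → Q y → ¬ P y → h y ≡ y → length (filter P? L) < length (filter Q? L)
  involution-count {P} P? Q? {L} L-uniq h h-invol h-PQ y y∈L Qy ¬Py hy≡y = begin-strict
    length (filter P? L)            ≡⟨ LP.length-map h (filter P? L) ⟨
    length (L.map h (filter P? L))  <⟨ ℕP.≤-refl ⟩
    length (y ∷ L.map h (filter P? L)) ≤⟨ unique-⊆-length image-unique image⊆ ⟩
    length (filter Q? L)            ∎
    where
    open ℕP.≤-Reasoning
    in-P : ∀ {x} → x ∈ filter P? L → x ∈ L × P x
    in-P = MP.∈-filter⁻ P?
    h-inj : ∀ {x z} → x ∈ filter P? L → z ∈ filter P? L → h x ≡ h z → x ≡ z
    h-inj x∈ z∈ eq = trans (sym (h-invol (proj₁ (in-P x∈)))) (trans (cong h eq) (h-invol (proj₁ (in-P z∈))))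
    y∉image : ∀ {z} → z ∈ L.map h (filter P? L) → y ≢ z
    y∉image z∈ y≡z with MP.∈-map⁻ h z∈
    ... | x , x∈ , refl = ¬Py (subst P (trans (sym (h-invol (proj₁ (in-P x∈)))) (trans (cong h (sym y≡z)) hy≡y)) (proj₂ (in-P x∈)))
    image-unique : Unique (y ∷ L.map h (filter P? L))
    image-unique = All.tabulate y∉image ∷ unique-map h h-inj (UP.filter⁺ P? L-uniq)
    image⊆ : ∀ {z} → z ∈ y ∷ L.map h (filter P? L) → z ∈ filter Q? L
    image⊆ (here refl) = MP.∈-filter⁺ Q? y∈L Qy
    image⊆ (there z∈) with MP.∈-map⁻ h z∈
    ... | x , x∈ , refl = let (hx∈L , Qhx) = h-PQ (proj₁ (in-P x∈)) (proj₂ (in-P x∈)) in MP.∈-filter⁺ Q? hx∈L Qhx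

OrderedPairs : (n : ℕ) → List (Fin n × Fin n)
OrderedPairs n = filter (λ ij → proj₁ ij F.<? proj₂ ij) (L.cartesianProduct (allFin n) (allFin n))

ordered-pairs-unique : (n : ℕ) → Unique (OrderedPairs n)
ordered-pairs-unique n =
  UP.filter⁺ (λ ij → proj₁ ij F.<? proj₂ ij) (UP.cartesianProduct⁺ (UP.allFin⁺ n) (UP.allFin⁺ n))

ordered-pair∈ : {i j : Fin n} → i F.< j → (i , j) ∈ OrderedPairs n
ordered-pair∈ i<j =
  MP.∈-filter⁺ (λ ij → proj₁ ij F.<? proj₂ ij) (MP.∈-cartesianProduct⁺ (MP.∈-allFin _) (MP.∈-allFin _)) i<j

∈⇒ordered : {p : Fin n × Fin n} → p ∈ OrderedPairs n → proj₁ p F.< proj₂ p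
∈⇒ordered {n} p∈ =
  proj₂ (MP.∈-filter⁻ (λ ij → proj₁ ij F.<? proj₂ ij) {xs = L.cartesianProduct (allFin n) (allFin n)} p∈)

-- The involution of ordered pairs used for the count applies (a b)
-- to both positions when this keeps the pair ordered, and fixes it otherwise;
-- (a,b) itself is a fixed point that becomes an inversion.
module AscentSwap (w : Word n) (a b : Fin n) (a<b : a F.< b) (wa<wb : lookup w a F.< lookup w b) where

  τ : Fin n → Fin n
  τ = transpose a b

  u : Word n
  u = w · (a , b)

  Inversion : Word n → Fin n × Fin n → Set
  Inversion v (i , j) = lookup v j F.< lookup v i

  inversion? : ∀ v → Decidable (Inversion v)
  inversion? v (i , j) = lookup v j F.<? lookup v i

  u-after-τ : ∀ c → lookup u (τ c) ≡ lookup w c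
  u-after-τ c = trans (swap-lookup w a b (τ c)) (cong (lookup w) (transpose-involutive a b c))

  reorder : Fin n × Fin n → Fin n × Fin n
  reorder (i , j) with τ i F.<? τ j
  ... | yes _ = (τ i , τ j)
  ... | no _ = (i , j)

  reorder-moved : ∀ i j → τ i F.< τ j → reorder (i , j) ≡ (τ i , τ j)
  reorder-moved i j lt with τ i F.<? τ j
  ... | yes _ = refl
  ... | no ¬lt = ⊥-elim (¬lt lt)

  reorder-fixed : ∀ i j → ¬ τ i F.< τ j → reorder (i , j) ≡ (i , j)
  reorder-fixed i j ¬lt with τ i F.<? τ j
  ... | yes lt = ⊥-elim (¬lt lt)
  ... | no _ = refl

  reorder-involutive : ∀ i j → i F.< j → reorder (reorder (i , j)) ≡ (i , j)
  reorder-involutive i j i<j with τ i F.<? τ j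
  ... | yes _ = trans (reorder-moved (τ i) (τ j) (subst₂ F._<_ (sym (ττ i)) (sym (ττ j)) i<j)) (cong₂ _,_ (ττ i) (ττ j))
    where
    ττ : ∀ c → τ (τ c) ≡ c
    ττ = transpose-involutive a b
  ... | no ¬lt = reorder-fixed i j ¬lt

  -- An inversion (i,j) of w whose order is reversed by τ is also an inversion of u:
  -- such a pair meets {a,b}, and the ascent w(a) < w(b) settles each case.
  reversed-inversion : ∀ i j → Dec (i ≡ a) → Dec (i ≡ b) → Dec (j ≡ a) → Dec (j ≡ b) →
    i F.< j → ¬ τ i F.< τ j → Inversion w (i , j) → Inversion u (i , j)
  reversed-inversion i j (yes refl) _ _ (yes refl) _ _ inv = ⊥-elim (FP.<-asym wa<wb inv)
  reversed-inversion i j (yes refl) _ _ (no j≢b) i<j _ inv =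
    subst₂ F._<_ (sym (swap-elsewhere w a b j (λ j≡a → FP.<-irrefl (sym j≡a) i<j) j≢b)) (sym (swap-at-fst w a b))
      (FP.<-trans inv wa<wb)
  reversed-inversion i j (no _) (yes refl) _ _ i<j ¬lt _ = ⊥-elim (¬lt (subst₂ F._<_ (sym (transpose-snd a b))
    (sym (transpose-other a b j (λ j≡a → FP.<-asym a<b (subst (b F.<_) j≡a i<j)) (λ j≡b → FP.<-irrefl (sym j≡b) i<j)))
    (FP.<-trans a<b i<j)))
  reversed-inversion i j (no i≢a) (no i≢b) (yes refl) _ i<j ¬lt _ =
    ⊥-elim (¬lt (subst₂ F._<_ (sym (transpose-other a b i i≢a i≢b)) (sym (transpose-fst a b)) (FP.<-trans i<j a<b)))
  reversed-inversion i j (no i≢a) (no i≢b) (no _) (yes refl) _ _ inv =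
    subst₂ F._<_ (sym (swap-at-snd w a b)) (sym (swap-elsewhere w a b i i≢a i≢b)) (FP.<-trans wa<wb inv)
  reversed-inversion i j (no i≢a) (no i≢b) (no j≢a) (no j≢b) _ _ inv =
    subst₂ F._<_ (sym (swap-elsewhere w a b j j≢a j≢b)) (sym (swap-elsewhere w a b i i≢a i≢b)) inv

  reorder-inversion : ∀ i j → i F.< j → Inversion w (i , j) →
    (proj₁ (reorder (i , j)) F.< proj₂ (reorder (i , j))) × Inversion u (reorder (i , j))
  reorder-inversion i j i<j inv with τ i F.<? τ j
  ... | yes lt = lt , subst₂ F._<_ (sym (u-after-τ j)) (sym (u-after-τ i)) inv
  ... | no ¬lt = i<j , reversed-inversion i j (i F.≟ a) (i F.≟ b) (j F.≟ a) (j F.≟ b) i<j ¬lt inv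

  length-increases : len w < len u
  length-increases = involution-count (inversion? w) (inversion? u) (ordered-pairs-unique n) reorder
    (λ {p} p∈ → reorder-involutive (proj₁ p) (proj₂ p) (∈⇒ordered p∈))
    (λ {p} p∈ inv → let (ordered , inv′) = reorder-inversion (proj₁ p) (proj₂ p) (∈⇒ordered p∈) inv in ordered-pair∈ ordered , inv′)
    (a , b) (ordered-pair∈ a<b) (subst₂ F._<_ (sym (swap-at-snd w a b)) (sym (swap-at-fst w a b)) wa<wb) (FP.<-asym wa<wb)
    (reorder-fixed a b (λ lt → FP.<-asym a<b (subst₂ F._<_ (transpose-fst a b) (transpose-snd a b) lt)))

len-swap-ascent : (w : Word n) (a b : Fin n) → a F.< b → lookup w a F.< lookup w b → len w < len (w · (a , b))
len-swap-ascent = AscentSwap.length-increases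

≤B⇒len≤ : {u w : Word n} → u ≤B w → len u ≤ len w
≤B⇒len≤ ε = ℕP.≤-refl
≤B⇒len≤ ((t , _ , refl , len<) ◅ steps) = ℕP.≤-trans (ℕP.<⇒≤ len<) (≤B⇒len≤ steps)

descent-of-decrease : (w : Word n) (a b : Fin n) → a F.< b → (w · (a , b)) <B w → lookup w b F.< lookup w a
descent-of-decrease w a b a<b (w′≤w , w′≢w) with FP.<-cmp (lookup w a) (lookup w b)
... | tri< ascent _ _ = ⊥-elim (ℕP.<⇒≱ (len-swap-ascent w a b a<b ascent) (≤B⇒len≤ w′≤w))
... | tri≈ _ equal _ = ⊥-elim (w′≢w (swap-trivial w a b equal))
... | tri> _ _ descent = descent

decrease-of-ascent : (z : Word n) (a b : Fin n) → a F.< b → lookup z a F.< lookup z b →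
  ((z · (a , b)) · (a , b)) <B (z · (a , b))
decrease-of-ascent z a b a<b ascent = ((a , b) , a<b , step , shorter) ◅ ε , differ
  where
  back = swap-involutive z a b
  step : z · (a , b) ≡ ((z · (a , b)) · (a , b)) · (a , b)
  step = sym (cong (_· (a , b)) back)
  shorter : len ((z · (a , b)) · (a , b)) < len (z · (a , b))
  shorter = subst (λ v → len v < len (z · (a , b))) (sym back) (len-swap-ascent z a b a<b ascent)
  differ : (z · (a , b)) · (a , b) ≢ z · (a , b)
  differ eq = FP.<-irrefl (trans (cong (λ v → lookup v a) (trans (sym back) eq)) (swap-at-fst z a b)) ascent

·*-++ : (w : Word n) (xs ys : List (Transp n)) → w ·* (xs ++ ys) ≡ (w ·* xs) ·* ys
·*-++ w [] ys = refl
·*-++ w (t ∷ xs) ys = ·*-++ (w · t) xs ys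

·*-injective : (w : Word n) (ts : List (Transp n)) → IsInjective w → IsInjective (w ·* ts)
·*-injective w [] w-inj = w-inj
·*-injective w ((a , b) ∷ ts) w-inj = ·*-injective (w · (a , b)) ts (swap-injective w a b w-inj)

·*-untouched : (w : Word n) (ts : List (Transp n)) (c : Fin n) →
  All (λ t → (c ≢ proj₁ t) × (c ≢ proj₂ t)) ts → lookup (w ·* ts) c ≡ lookup w c
·*-untouched w [] c _ = refl
·*-untouched w ((a , b) ∷ ts) c ((c≢a , c≢b) ∷ rest) =
  trans (·*-untouched (w · (a , b)) ts c rest) (swap-elsewhere w a b c c≢a c≢b)

chain-suffix : (w : Word n) (xs ys : List (Transp n)) → DecChain w (xs ++ ys) → DecChain (w ·* xs) ys
chain-suffix w [] ys chain = chain
chain-suffix w (t ∷ xs) ys (_ , chain) = chain-suffix (w · t) xs ys chain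

chain-prefix : (w : Word n) (xs ys : List (Transp n)) → DecChain w (xs ++ ys) → DecChain w xs
chain-prefix w [] ys _ = tt
chain-prefix w (t ∷ xs) ys (step , chain) = step , chain-prefix (w · t) xs ys chain

module _ {A : Set} where

  select-⊆ : (xs : List A) (m : List Bool) → ∀ {x} → x ∈ select xs m → x ∈ xs
  select-⊆ [] _ ()
  select-⊆ (x ∷ xs) [] ()
  select-⊆ (x ∷ xs) (true ∷ m) (here refl) = here refl
  select-⊆ (x ∷ xs) (true ∷ m) (there x∈) = there (select-⊆ xs m x∈)
  select-⊆ (x ∷ xs) (false ∷ m) x∈ = there (select-⊆ xs m x∈)

  select-all : {P : A → Set} (xs : List A) (m : List Bool) → All P xs → All P (select xs m)
  select-all xs m all-P = All.tabulate (λ x∈ → All.lookup all-P (select-⊆ xs m x∈))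

  select-allPairs : {R : A → A → Set} (xs : List A) (m : List Bool) → AllPairs R xs → AllPairs R (select xs m)
  select-allPairs [] _ _ = []
  select-allPairs (x ∷ xs) [] _ = []
  select-allPairs (x ∷ xs) (true ∷ m) (Rx ∷ R-xs) =
    All.tabulate (λ y∈ → All.lookup Rx (select-⊆ xs m y∈)) ∷ select-allPairs xs m R-xs
  select-allPairs (x ∷ xs) (false ∷ m) (_ ∷ R-xs) = select-allPairs xs m R-xs

  select-++ : (xs ys : List A) (mx my : List Bool) → length mx ≡ length xs →
    select (xs ++ ys) (mx ++ my) ≡ select xs mx ++ select ys my
  select-++ [] ys [] my _ = refl
  select-++ (x ∷ xs) ys (true ∷ mx) my eq = cong (x ∷_) (select-++ xs ys mx my (ℕP.suc-injective eq))
  select-++ (x ∷ xs) ys (false ∷ mx) my eq = select-++ xs ys mx my (ℕP.suc-injective eq)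

  split-mask : (xs ys : List A) (m : List Bool) → IsMask (xs ++ ys) m →
    Σ (List Bool) λ mx → Σ (List Bool) λ my → (m ≡ mx ++ my) × IsMask xs mx × IsMask ys my
  split-mask [] ys m m-len = [] , m , refl , refl , m-len
  split-mask (x ∷ xs) ys (b ∷ m) m-len with split-mask xs ys m (ℕP.suc-injective m-len)
  ... | mx , my , refl , mx-len , my-len = b ∷ mx , my , refl , cong suc mx-len , my-len

  split-mask₃ : (xs ys zs : List A) (m : List Bool) → IsMask (xs ++ ys ++ zs) m →
    Σ (List Bool) λ mx → Σ (List Bool) λ my → Σ (List Bool) λ mz → (m ≡ mx ++ my ++ mz) × IsMask xs mx × IsMask ys my
  split-mask₃ xs ys zs m m-len with split-mask xs (ys ++ zs) m m-len
  ... | mx , mr , refl , mx-len , mr-len with split-mask ys zs mr mr-len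
  ...   | my , mz , refl , my-len , _ = mx , my , mz , refl , mx-len , my-len

module _ {A B : Set} where

  select-map : (f : A → B) (xs : List A) (m : List Bool) → select (L.map f xs) m ≡ L.map f (select xs m)
  select-map f [] m = refl
  select-map f (x ∷ xs) [] = refl
  select-map f (x ∷ xs) (true ∷ m) = cong (f x ∷_) (select-map f xs m)
  select-map f (x ∷ xs) (false ∷ m) = select-map f xs m

  all-concatMap : {P : B → Set} (f : A → List B) (xs : List A) →
    (∀ {x} → x ∈ xs → All P (f x)) → All P (concatMap f xs)
  all-concatMap f xs all-P = All.tabulate λ y∈ →
    let (x , x∈ , y∈fx) = find (MP.∈-concatMap⁻ f {xs = xs} y∈) in All.lookup (all-P x∈) y∈fx

module _ {A B : Set} where

  allPairs-concatMap : {R : B → B → Set} {S : A → A → Set} (f : A → List B) (xs : List A) →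
    (∀ x → AllPairs R (f x)) → (∀ {x y} → S x y → ∀ {u v} → u ∈ f x → v ∈ f y → R u v) →
    AllPairs S xs → AllPairs R (concatMap f xs)
  allPairs-concatMap f [] _ _ _ = []
  allPairs-concatMap {R} f (x ∷ xs) R-pieces R-across (S-x ∷ S-xs) =
    APP.++⁺ (R-pieces x) (allPairs-concatMap f xs R-pieces R-across S-xs)
            (All.tabulate λ u∈ → All.tabulate λ v∈ → later u∈ v∈)
    where
    later : ∀ {u v} → u ∈ f x → v ∈ concatMap f xs → R u v
    later u∈ v∈ with find (MP.∈-concatMap⁻ f {xs = xs} v∈)
    ... | y , y∈ , v∈fy = R-across (All.lookup S-x y∈) u∈ v∈fy

allPairs-everywhere : {A : Set} {R : A → A → Set} → (∀ x y → R x y) → (xs : List A) → AllPairs R xs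
allPairs-everywhere R-all [] = []
allPairs-everywhere R-all (x ∷ xs) = All.tabulate (λ {y} _ → R-all x y) ∷ allPairs-everywhere R-all xs

Rows : (n k : ℕ) → List (Fin n)
Rows n k = filter (λ a → suc (toℕ a) ℕ.≤? k) (allFin n)

Cols : (n k : ℕ) → List (Fin n)
Cols n k = filter (λ b → k ℕ.≤? toℕ b) (allFin n)

row : (n k : ℕ) → Fin n → List (Transp n)
row n k a = L.map (a ,_) (reverse (Cols n k))

Straddles : ℕ → Transp n → Set
Straddles k (a , b) = (toℕ a < k) × (k ≤ toℕ b)

Γk-straddles : (n k : ℕ) → All (Straddles k) (Γk n k)
Γk-straddles n k = all-concatMap (row n k) (Rows n k) λ {a} a∈ → All.tabulate λ t∈ → straddle a∈ t∈
  where
  straddle : ∀ {a t} → a ∈ Rows n k → t ∈ row n k a → Straddles k t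
  straddle {a} a∈ t∈ with MP.∈-map⁻ (a ,_) t∈
  ... | b , b∈ , refl = proj₂ (MP.∈-filter⁻ (λ a → suc (toℕ a) ℕ.≤? k) {xs = allFin n} a∈) ,
                        proj₂ (MP.∈-filter⁻ (λ b → k ℕ.≤? toℕ b) {xs = allFin n} (AnyP.reverse⁻ b∈))

Γk-rows-sorted : (n k : ℕ) → AllPairs (λ t t′ → proj₁ t F.≤ proj₁ t′) (Γk n k)
Γk-rows-sorted n k = allPairs-concatMap (row n k) (Rows n k)
  (λ a → APP.map⁺ (allPairs-everywhere (λ _ _ → FP.≤-refl) (reverse (Cols n k))))
  across (APP.filter⁺ _ (APP.tabulate⁺-< {R = F._<_} (λ lt → lt)))
  where
  first : ∀ {a t} → t ∈ row n k a → proj₁ t ≡ a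
  first {a} t∈ with MP.∈-map⁻ (a ,_) t∈
  ... | _ , _ , refl = refl
  across : ∀ {a a′} → a F.< a′ → ∀ {t t′} → t ∈ row n k a → t′ ∈ row n k a′ → proj₁ t F.≤ proj₁ t′
  across a<a′ t∈ t′∈ rewrite first t∈ | first t′∈ = ℕP.<⇒≤ a<a′

Tagged : ℕ → Set
Tagged n = ℕ × Transp n

Γblock : (n : ℕ) (p : List ℕ) → ℕ → List (Tagged n)
Γblock n p j = L.map (suc j ,_) (Γk n (conj p (suc j)))

Γ≤ : (n : ℕ) (p : List ℕ) → ℕ → List (Tagged n)
Γ≤ n p j = concatMap (Γblock n p) (downFrom j)

Γ-straddles : (n : ℕ) (p : List ℕ) → All (λ e → Straddles (conj p (proj₁ e)) (proj₂ e)) (Γ n p)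
Γ-straddles n p = all-concatMap (Γblock n p) (downFrom (firstPart p)) λ {j} _ →
  AllP.map⁺ (Γk-straddles n (conj p (suc j)))

tag-Γblock : (n : ℕ) (p : List ℕ) (j : ℕ) {e : Tagged n} → e ∈ Γblock n p j → proj₁ e ≡ suc j
tag-Γblock n p j e∈ with MP.∈-map⁻ (suc j ,_) e∈
... | _ , _ , refl = refl

Γ≤-tags : (n : ℕ) (p : List ℕ) (j : ℕ) → All (λ e → ¬ suc j ≤ proj₁ e) (Γ≤ n p j)
Γ≤-tags n p j = all-concatMap (Γblock n p) (downFrom j) λ {l} l∈ → All.tabulate λ e∈ j<tag →
  ℕP.<-irrefl refl (ℕP.<-≤-trans (below j l∈) (ℕP.≤-pred (subst (suc j ≤_) (tag-Γblock n p l e∈) j<tag)))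
  where
  below : ∀ j {l} → l ∈ downFrom j → l < j
  below (suc j) (here refl) = ℕP.≤-refl
  below (suc j) (there l∈) = ℕP.m<n⇒m<1+n (below j l∈)

downFrom-split : {j : ℕ} (l : ℕ) → j ≤ l → ∃[ D ] (downFrom l ≡ D ++ downFrom j) × All (j ≤_) D
downFrom-split l j≤l with ℕP.m≤n⇒m<n∨m≡n j≤l
downFrom-split (suc l) _ | inj₁ (s≤s j≤l) with downFrom-split l j≤l
... | D , eq , D≥j = l ∷ D , cong (l ∷_) eq , j≤l ∷ D≥j
downFrom-split l _ | inj₂ refl = [] , refl , []

Γ-split : (n : ℕ) (p : List ℕ) (j : ℕ) → j ≤ firstPart p →
  ∃[ P ] (Γ n p ≡ P ++ Γ≤ n p j) × All (λ e → suc j ≤ proj₁ e) P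
Γ-split n p j j≤λ₁ with downFrom-split (firstPart p) j≤λ₁
... | D , eq , D≥j = concatMap (Γblock n p) D ,
  trans (cong (concatMap (Γblock n p)) eq) (LP.concatMap-++ (Γblock n p) D (downFrom j)) ,
  all-concatMap (Γblock n p) D λ {l} l∈ → All.tabulate λ e∈ →
    subst (suc j ≤_) (sym (tag-Γblock n p l e∈)) (s≤s (All.lookup D≥j l∈))

transps : List (Tagged n) → List Bool → List (Transp n)
transps L m = L.map proj₂ (select L m)

transps-++ : (xs ys : List (Tagged n)) (mx my : List Bool) → IsMask xs mx →
  transps (xs ++ ys) (mx ++ my) ≡ transps xs mx ++ transps ys my
transps-++ xs ys mx my mx-len =
  trans (cong (L.map proj₂) (select-++ xs ys mx my mx-len)) (LP.map-++ proj₂ (select xs mx) (select ys my))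

transps-Γblock : (n : ℕ) (p : List ℕ) (j : ℕ) (m : List Bool) →
  transps (Γblock n p j) m ≡ select (Γk n (conj p (suc j))) m
transps-Γblock n p j m = begin
  L.map proj₂ (select (L.map (suc j ,_) G) m)     ≡⟨ cong (L.map proj₂) (select-map (suc j ,_) G m) ⟩
  L.map proj₂ (L.map (suc j ,_) (select G m))     ≡⟨ LP.map-∘ (select G m) ⟨
  L.map (λ t → t) (select G m)                   ≡⟨ LP.map-id (select G m) ⟩
  select G m                                     ∎
  where
  open ≡-Reasoning
  G = Γk n (conj p (suc j))

πj-prefix : (p : List ℕ) (w : Word n) (j : ℕ) (P : List (Tagged n)) (mP mQ : List Bool) →
  Γ n p ≡ P ++ Γ≤ n p j → IsMask P mP → All (λ e → suc j ≤ proj₁ e) P →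
  πj p w (mP ++ mQ) j ≡ w ·* transps P mP
πj-prefix {n} p w j P mP mQ Γ-eq mP-len P-above = cong (λ L → w ·* L.map proj₂ L) (begin
  above (select (Γ n p) (mP ++ mQ))           ≡⟨ cong (λ L → above (select L (mP ++ mQ))) Γ-eq ⟩
  above (select (P ++ Q) (mP ++ mQ))          ≡⟨ cong above (select-++ P Q mP mQ mP-len) ⟩
  above (select P mP ++ select Q mQ)          ≡⟨ LP.filter-++ above? (select P mP) (select Q mQ) ⟩
  above (select P mP) ++ above (select Q mQ)  ≡⟨ cong₂ _++_ (LP.filter-all above? (select-all P mP P-above))
                                                           (LP.filter-none above? (select-all Q mQ (Γ≤-tags n p j))) ⟩
  select P mP ++ []                           ≡⟨ LP.++-identityʳ (select P mP) ⟩
  select P mP                                 ∎)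
  where
  open ≡-Reasoning
  Q = Γ≤ n p j
  above? : Decidable (λ (e : Tagged n) → suc j ≤ proj₁ e)
  above? e = suc j ℕ.≤? proj₁ e
  above : List (Tagged n) → List (Tagged n)
  above = filter above?

ColumnStep : List ℕ → Word n → List Bool → ℕ → Set
ColumnStep {n} p w m j =
  ∃[ mB ] (πj p w m j ≡ πj p w m (suc j) ·* B mB) × (DecChain w (Tseq p m) → DecChain (πj p w m (suc j)) (B mB))
  where
  B : List Bool → List (Transp n)
  B = select (Γk n (conj p (suc j)))

column-step-split : (p : List ℕ) (w : Word n) (j : ℕ) (P : List (Tagged n)) (mP mB mQ : List Bool) →
  Γ n p ≡ P ++ Γblock n p j ++ Γ≤ n p j → IsMask P mP → IsMask (Γblock n p j) mB →
  All (λ e → suc (suc j) ≤ proj₁ e) P → ColumnStep p w (mP ++ mB ++ mQ) j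
column-step-split {n} p w j P mP mB mQ Γ-eq mP-len mB-len P-above = mB , π-step , chain-step
  where
  open ≡-Reasoning
  m = mP ++ mB ++ mQ
  G = Γblock n p j
  Q = Γ≤ n p j
  B = select (Γk n (conj p (suc j))) mB

  π-next : πj p w m (suc j) ≡ w ·* transps P mP
  π-next = πj-prefix p w (suc j) P mP (mB ++ mQ) Γ-eq mP-len P-above

  head-eq : Γ n p ≡ (P ++ G) ++ Q
  head-eq = trans Γ-eq (sym (LP.++-assoc P G Q))
  head-mask : IsMask (P ++ G) (mP ++ mB)
  head-mask = trans (LP.length-++ mP) (trans (cong₂ ℕ._+_ mP-len mB-len) (sym (LP.length-++ P)))
  head-above : All (λ e → suc j ≤ proj₁ e) (P ++ G)
  head-above = AllP.++⁺ (All.map ℕP.<⇒≤ P-above) (All.tabulate (λ e∈ → ℕP.≤-reflexive (sym (tag-Γblock n p j e∈))))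

  π-step : πj p w m j ≡ πj p w m (suc j) ·* B
  π-step = begin
    πj p w m j                             ≡⟨ cong (λ m → πj p w m j) (LP.++-assoc mP mB mQ) ⟨
    πj p w ((mP ++ mB) ++ mQ) j            ≡⟨ πj-prefix p w j (P ++ G) (mP ++ mB) mQ head-eq head-mask head-above ⟩
    w ·* transps (P ++ G) (mP ++ mB)       ≡⟨ cong (w ·*_) (transps-++ P G mP mB mP-len) ⟩
    w ·* (transps P mP ++ transps G mB)    ≡⟨ ·*-++ w (transps P mP) _ ⟩
    (w ·* transps P mP) ·* transps G mB    ≡⟨ cong₂ _·*_ (sym π-next) (transps-Γblock n p j mB) ⟩
    πj p w m (suc j) ·* B                  ∎

  T-split : Tseq p m ≡ transps P mP ++ B ++ transps Q mQ
  T-split = begin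
    transps (Γ n p) m                      ≡⟨ cong (λ L → transps L m) Γ-eq ⟩
    transps (P ++ G ++ Q) m                ≡⟨ transps-++ P (G ++ Q) mP (mB ++ mQ) mP-len ⟩
    transps P mP ++ transps (G ++ Q) (mB ++ mQ) ≡⟨ cong (transps P mP ++_) (transps-++ G Q mB mQ mB-len) ⟩
    transps P mP ++ transps G mB ++ transps Q mQ ≡⟨ cong (λ T → transps P mP ++ T ++ transps Q mQ) (transps-Γblock n p j mB) ⟩
    transps P mP ++ B ++ transps Q mQ      ∎

  chain-step : DecChain w (Tseq p m) → DecChain (πj p w m (suc j)) B
  chain-step chain = subst (λ v → DecChain v B) (sym π-next)
    (chain-prefix _ B (transps Q mQ) (chain-suffix w (transps P mP) _ (subst (DecChain w) T-split chain)))

column-step : (p : List ℕ) (w : Word n) (m : List Bool) (j : ℕ) → IsMask (Γ n p) m → suc j ≤ firstPart p →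
  ColumnStep p w m j
column-step {n} p w m j m-len j<λ₁ = from-head (Γ-split n p (suc j) j<λ₁)
  where
  from-head : ∃[ P ] (Γ n p ≡ P ++ Γ≤ n p (suc j)) × All (λ e → suc (suc j) ≤ proj₁ e) P → ColumnStep p w m j
  from-head (P , Γ-eq , P-above) =
    let (mP , mB , mQ , m-eq , mP-len , mB-len) =
          split-mask₃ P (Γblock n p j) (Γ≤ n p j) m (subst (λ L → IsMask L m) Γ-eq m-len)
    in subst (λ m → ColumnStep p w m j) (sym m-eq) (column-step-split p w j P mP mB mQ Γ-eq mP-len mB-len P-above)

straddling-chain-lowers : (k : ℕ) (x : Word n) (B : List (Transp n)) → All (Straddles k) B → DecChain x B →
  ∀ i → toℕ i < k → lookup (x ·* B) i F.≤ lookup x i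
straddling-chain-lowers k x [] _ _ i _ = FP.≤-refl
straddling-chain-lowers k x ((a , b) ∷ B) ((a<k , k≤b) ∷ straddle) (step , chain) i i<k with i F.≟ a
... | yes refl = ℕP.≤-trans (straddling-chain-lowers k (x · (i , b)) B straddle chain i i<k)
                   (ℕP.≤-trans (ℕP.≤-reflexive (cong toℕ (swap-at-fst x i b)))
                               (ℕP.<⇒≤ (descent-of-decrease x i b (ℕP.<-≤-trans a<k k≤b) step)))
... | no i≢a = ℕP.≤-trans (straddling-chain-lowers k (x · (a , b)) B straddle chain i i<k)
                 (ℕP.≤-reflexive (cong toℕ (swap-elsewhere x a b i i≢a i≢b)))
  where
  i≢b : i ≢ b
  i≢b refl = ℕP.<-irrefl refl (ℕP.<-≤-trans i<k k≤b)

-- If moreover the first coordinates weakly increase along B and x is injective,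
-- then no position c < i (i < k) ends up holding the value x(i): the only
-- transposition that moves x(i) is one starting at i, and nothing after it
-- touches c.
straddling-sorted-avoids : (k : ℕ) (x : Word n) (B : List (Transp n)) → All (Straddles k) B →
  AllPairs (λ t t′ → proj₁ t F.≤ proj₁ t′) B → IsInjective x →
  ∀ c i → c F.< i → toℕ i < k → lookup (x ·* B) c ≢ lookup x i
straddling-sorted-avoids k x [] _ _ x-inj c i c<i _ eq = FP.<-irrefl (x-inj eq) c<i
straddling-sorted-avoids k x ((a , b) ∷ B) ((a<k , k≤b) ∷ straddle) (a≤later ∷ sorted) x-inj c i c<i i<k eq
  with i F.≟ a
... | no i≢a = straddling-sorted-avoids k (x · (a , b)) B straddle sorted (swap-injective x a b x-inj) c i c<i i<k
                 (trans eq (sym (swap-elsewhere x a b i i≢a i≢b)))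
  where
  i≢b : i ≢ b
  i≢b refl = ℕP.<-irrefl refl (ℕP.<-≤-trans i<k k≤b)
... | yes refl = FP.<-irrefl (x-inj (trans (sym c-kept) eq)) c<i
  where
  c<b : ∀ {b′} → k ≤ toℕ b′ → c F.< b′
  c<b k≤b′ = ℕP.<-≤-trans (ℕP.<-trans c<i i<k) k≤b′
  c-kept : lookup ((x · (i , b)) ·* B) c ≡ lookup x c
  c-kept = trans (·*-untouched (x · (i , b)) B c
                   (All.zipWith (λ { (i≤a′ , (_ , k≤b′)) → (λ c≡a′ → FP.<-irrefl c≡a′ (ℕP.<-≤-trans c<i i≤a′)) ,
                                                           (λ c≡b′ → FP.<-irrefl c≡b′ (c<b k≤b′)) })
                                (a≤later , straddle)))
                 (swap-elsewhere x i b c (λ c≡i → FP.<-irrefl c≡i c<i) (λ c≡b → FP.<-irrefl c≡b (c<b k≤b)))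

Decreasing : List ℕ → Set
Decreasing = AllPairs (λ x y → y ≤ x)

partition-decreasing : {p : List ℕ} → IsPartition p → Decreasing p
partition-decreasing (_ , linked) = LkP.Linked⇒AllPairs (λ y≤x z≤y → ℕP.≤-trans z≤y y≤x) linked

part-bounded : {y : ℕ} (p : List ℕ) → All (_≤ y) p → ∀ x → part p x ≤ y
part-bounded [] _ x = z≤n
part-bounded (z ∷ p) (z≤y ∷ _) zero = z≤y
part-bounded (z ∷ p) (_ ∷ p≤y) (suc x) = part-bounded p p≤y x

part≤firstPart : (p : List ℕ) → Decreasing p → ∀ x → part p x ≤ firstPart p
part≤firstPart [] _ x = z≤n
part≤firstPart (z ∷ p) _ zero = ℕP.≤-refl
part≤firstPart (z ∷ p) (p≤z ∷ _) (suc x) = part-bounded p p≤z x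

conj-∷-≤ : {j y : ℕ} (p : List ℕ) → j ≤ y → conj (y ∷ p) j ≡ suc (conj p j)
conj-∷-≤ {j} p j≤y = cong length (LP.filter-accept (j ℕ.≤?_) j≤y)

conj-∷-> : {j y : ℕ} (p : List ℕ) → ¬ j ≤ y → conj (y ∷ p) j ≡ conj p j
conj-∷-> {j} p j≰y = cong length (LP.filter-reject (j ℕ.≤?_) j≰y)

conj-above : {y j : ℕ} (p : List ℕ) → All (_≤ y) p → y < j → conj p j ≡ 0
conj-above [] _ _ = refl
conj-above {j = j} (z ∷ p) (z≤y ∷ p≤y) y<j = trans (conj-∷-> p j≰z) (conj-above p p≤y y<j)
  where
  j≰z : ¬ j ≤ z
  j≰z j≤z = ℕP.<-irrefl refl (ℕP.<-≤-trans y<j (ℕP.≤-trans j≤z z≤y))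

conj⇒part : (p : List ℕ) → Decreasing p → ∀ j x → x < conj p j → j ≤ part p x
conj⇒part [] _ j x ()
conj⇒part (y ∷ p) (p≤y ∷ dec) j x x<conj with j ℕ.≤? y
conj⇒part (y ∷ p) (p≤y ∷ dec) j zero _ | yes j≤y = j≤y
conj⇒part (y ∷ p) (p≤y ∷ dec) j (suc x) x<conj | yes j≤y =
  conj⇒part p dec j x (ℕP.≤-pred (subst (suc (suc x) ≤_) (conj-∷-≤ p j≤y) x<conj))
... | no j≰y = ⊥-elim (ℕP.n≮0 (subst (x <_) (trans (conj-∷-> p j≰y) (conj-above p p≤y (ℕP.≰⇒> j≰y))) x<conj))

part⇒conj : (p : List ℕ) → Decreasing p → ∀ j x → 1 ≤ j → j ≤ part p x → x < conj p j
part⇒conj [] _ j x 1≤j j≤0 = ⊥-elim (ℕP.<-irrefl refl (ℕP.<-≤-trans 1≤j j≤0))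
part⇒conj (y ∷ p) (p≤y ∷ dec) j x 1≤j j≤part with j ℕ.≤? y
part⇒conj (y ∷ p) (p≤y ∷ dec) j zero 1≤j _ | yes j≤y = subst (0 <_) (sym (conj-∷-≤ p j≤y)) (s≤s z≤n)
part⇒conj (y ∷ p) (p≤y ∷ dec) j (suc x) 1≤j j≤part | yes j≤y =
  subst (suc x <_) (sym (conj-∷-≤ p j≤y)) (s≤s (part⇒conj p dec j x 1≤j j≤part))
part⇒conj (y ∷ p) (p≤y ∷ dec) j zero 1≤j j≤part | no j≰y = ⊥-elim (j≰y j≤part)
part⇒conj (y ∷ p) (p≤y ∷ dec) j (suc x) 1≤j j≤part | no j≰y =
  ⊥-elim (j≰y (ℕP.≤-trans j≤part (part-bounded p p≤y x)))

πj-injective : (p : List ℕ) (w : Word n) (m : List Bool) → IsInjective w → ∀ j → IsInjective (πj p w m j)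
πj-injective {n} p w m w-inj j =
  ·*-injective w (L.map proj₂ (filter (λ e → suc j ℕ.≤? proj₁ e) (select (Γ n p) m))) w-inj

-- Inclusion f(𝒜(λ)) ⊆ ℱ(λ,n): columns are injective because each π_j is a
-- permutation, and the two remaining conditions come from the column step
-- π_j = π_{j+1} B with B ⊆ Γ(λ'_{j+1}).
fill-in-F : (p : List ℕ) → IsPartition p → (w : Word n) (m : List Bool) → InA p w m → InF p (fill p w m)
fill-in-F {n} p p-part w m ((w-perm , _) , m-len , chain) = columns , attack , rows
  where
  dec = partition-decreasing p-part
  w-inj = perm⇒injective w w-perm
  row-below : ∀ (i : Fin n) j → Cell p i (suc j) → toℕ i < conj p (suc j)
  row-below i j (_ , j≤λᵢ) = part⇒conj p dec (suc j) (toℕ i) (s≤s z≤n) j≤λᵢ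
  B : ℕ → List Bool → List (Transp n)
  B j mB = select (Γk n (conj p (suc j))) mB
  step : ∀ (i : Fin n) j → Cell p i (suc j) → ColumnStep p w m j
  step i j (_ , j≤λᵢ) = column-step p w m j m-len (ℕP.≤-trans j≤λᵢ (part≤firstPart p dec (toℕ i)))
  columns : ∀ (i k : Fin n) (j : ℕ) → Cell p i j → Cell p k j → i ≢ k → fill p w m i j ≢ fill p w m k j
  columns i k j _ _ i≢k eq = i≢k (πj-injective p w m w-inj j eq)
  attack : ∀ (i k : Fin n) (j : ℕ) → Cell p i (suc j) → Cell p k j → k F.< i → fill p w m i (suc j) ≢ fill p w m k j
  attack i k j cell _ k<i eq =
    let (mB , π-eq , _) = step i j cell in
    straddling-sorted-avoids (conj p (suc j)) (πj p w m (suc j)) (B j mB)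
      (select-all _ mB (Γk-straddles n _)) (select-allPairs _ mB (Γk-rows-sorted n _))
      (πj-injective p w m w-inj (suc j)) k i k<i (row-below i j cell) (sym (trans eq (cong (λ v → lookup v k) π-eq)))
  rows : ∀ (i : Fin n) (j : ℕ) → 1 ≤ j → Cell p i (suc j) → fill p w m i j F.≤ fill p w m i (suc j)
  rows i j _ cell =
    let (mB , π-eq , chain-B) = step i j cell in
    subst (λ v → lookup v i F.≤ fill p w m i (suc j)) (sym π-eq)
      (straddling-chain-lowers (conj p (suc j)) (πj p w m (suc j)) (B j mB) (select-all _ mB (Γk-straddles n _))
        (chain-B chain) i (row-below i j cell))

row-entries : ℕ → Fin n → List (Fin n) → List (Tagged n)
row-entries j a = L.map (λ b → (j , (a , b)))

block-entries : ℕ → ℕ → List (Tagged n)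
block-entries {n} j k = concatMap (λ a → row-entries j a (reverse (Cols n k))) (Rows n k)

Γblock-entries : (p : List ℕ) (j : ℕ) → Γblock n p j ≡ block-entries (suc j) (conj p (suc j))
Γblock-entries {n} p j = trans (LP.map-concatMap (suc j ,_) (row n k) (Rows n k))
  (LP.concatMap-cong (λ a → sym (LP.map-∘ (reverse (Cols n k)))) (Rows n k))
  where k = conj p (suc j)

-- A list L of tagged
-- transpositions is read from right to left starting at a word z; the entry
-- (j,(a,b)) is applied when it brings the value σ(a,j) into position a from
-- position b and this raises the entry at a (an ascent).  `start z L` is the
-- word obtained, `mask z L` records which entries were applied.
module Greedy {n : ℕ} (σ : Filling n) where

  Applies : Tagged n → Word n → Set
  Applies (j , (a , b)) z = (lookup z b ≡ σ a j) × (lookup z a F.< σ a j)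

  -- Kept opaque so that normalisation does not unfold the comparisons.
  opaque
    applies? : ∀ e z → Dec (Applies e z)
    applies? (j , (a , b)) z = (lookup z b F.≟ σ a j) ×-dec (lookup z a F.<? σ a j)

  swap-if : Bool → Word n → Transp n → Word n
  swap-if true z t = z · t
  swap-if false z t = z

  start : Word n → List (Tagged n) → Word n
  start z [] = z
  start z (e ∷ L) = swap-if (does (applies? e (start z L))) (start z L) (proj₂ e)

  mask : Word n → List (Tagged n) → List Bool
  mask z [] = []
  mask z (e ∷ L) = does (applies? e (start z L)) ∷ mask z L

  mask-length : ∀ z L → IsMask L (mask z L)
  mask-length z [] = refl
  mask-length z (e ∷ L) = cong suc (mask-length z L)

  start-++ : ∀ z xs ys → start z (xs ++ ys) ≡ start (start z ys) xs
  start-++ z [] ys = refl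
  start-++ z (e ∷ xs) ys rewrite start-++ z xs ys = refl

  mask-++ : ∀ z xs ys → mask z (xs ++ ys) ≡ mask (start z ys) xs ++ mask z ys
  mask-++ z [] ys = refl
  mask-++ z (e ∷ xs) ys rewrite start-++ z xs ys =
    cong (does (applies? e (start (start z ys) xs)) ∷_) (mask-++ z xs ys)

  start-·* : ∀ z L → start z L ·* transps L (mask z L) ≡ z
  start-·* z [] = refl
  start-·* z (e ∷ L) with applies? e (start z L)
  ... | yes _ = trans (cong (_·* transps L (mask z L)) (swap-involutive (start z L) (proj₁ (proj₂ e)) (proj₂ (proj₂ e))))
                      (start-·* z L)
  ... | no _ = start-·* z L

  start-injective : ∀ z L → IsInjective z → IsInjective (start z L)
  start-injective z [] z-inj = z-inj
  start-injective z (e ∷ L) z-inj with applies? e (start z L)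
  ... | yes _ = swap-injective (start z L) (proj₁ (proj₂ e)) (proj₂ (proj₂ e)) (start-injective z L z-inj)
  ... | no _ = start-injective z L z-inj

  -- Each applied transposition swapped an ascent, so forwards the chain decreases.
  start-chain : ∀ z L → All (λ e → proj₁ (proj₂ e) F.< proj₂ (proj₂ e)) L → DecChain (start z L) (transps L (mask z L))
  start-chain z [] _ = tt
  start-chain z ((j , (a , b)) ∷ L) (a<b ∷ ordered) with applies? (j , (a , b)) (start z L)
  ... | yes (zb≡ , za<) = decrease-of-ascent (start z L) a b a<b (subst (lookup (start z L) a F.<_) (sym zb≡) za<) ,
                          subst (λ v → DecChain v (transps L (mask z L))) (sym (swap-involutive (start z L) a b))
                            (start-chain z L ordered)
  ... | no _ = start-chain z L ordered

  module Row (j : ℕ) (a : Fin n) where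

    d : Fin n
    d = σ a j

    row-settled : ∀ z bs → lookup z a ≡ d → start z (row-entries j a bs) ≡ z
    row-settled z [] _ = refl
    row-settled z (b ∷ bs) za≡d with applies? (j , (a , b)) (start z (row-entries j a bs))
    ... | yes (_ , za<d) = ⊥-elim (FP.<-irrefl (trans (cong (λ v → lookup v a) (row-settled z bs za≡d)) za≡d) za<d)
    ... | no _ = row-settled z bs za≡d

    row-absent : ∀ z bs → All (λ b → lookup z b ≢ d) bs → start z (row-entries j a bs) ≡ z
    row-absent z [] _ = refl
    row-absent z (b ∷ bs) (zb≢d ∷ absent) with applies? (j , (a , b)) (start z (row-entries j a bs))
    ... | yes (zb≡d , _) = ⊥-elim (zb≢d (trans (sym (cong (λ v → lookup v b) (row-absent z bs absent))) zb≡d))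
    ... | no _ = row-absent z bs absent

    row-elsewhere : ∀ z bs c → c ≢ a → c ∉ bs → lookup (start z (row-entries j a bs)) c ≡ lookup z c
    row-elsewhere z [] c _ _ = refl
    row-elsewhere z (b ∷ bs) c c≢a c∉ with applies? (j , (a , b)) (start z (row-entries j a bs))
    ... | yes _ = trans (swap-elsewhere (start z (row-entries j a bs)) a b c c≢a (λ c≡b → c∉ (here c≡b)))
                        (row-elsewhere z bs c c≢a (λ c∈ → c∉ (there c∈)))
    ... | no _ = row-elsewhere z bs c c≢a (λ c∈ → c∉ (there c∈))

    row-fills : ∀ z bs → lookup z a F.< d → Any (λ b → lookup z b ≡ d) bs → lookup (start z (row-entries j a bs)) a ≡ d
    row-fills z (b ∷ bs) za<d found with Any.any? (λ b′ → lookup z b′ F.≟ d) bs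
    ... | yes found-later with applies? (j , (a , b)) (start z (row-entries j a bs))
    ...   | yes (_ , a-below) = ⊥-elim (FP.<-irrefl (row-fills z bs za<d found-later) a-below)
    ...   | no _ = row-fills z bs za<d found-later
    row-fills z (b ∷ bs) za<d found | no not-later = found-first found
      where
      unchanged : start z (row-entries j a bs) ≡ z
      unchanged = row-absent z bs (All.tabulate (λ {b′} b′∈ zb′≡d → not-later (Any.map (λ { refl → zb′≡d }) b′∈)))
      found-first : Any (λ b → lookup z b ≡ d) (b ∷ bs) → lookup (start z (row-entries j a (b ∷ bs))) a ≡ d
      found-first (there found-later) = ⊥-elim (not-later found-later)
      found-first (here zb≡d) with applies? (j , (a , b)) (start z (row-entries j a bs))
      ... | yes _ = trans (swap-at-fst (start z (row-entries j a bs)) a b) (trans (cong (λ v → lookup v b) unchanged) zb≡d)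
      ... | no not-applied = ⊥-elim (not-applied (subst (Applies (j , (a , b))) (sym unchanged) (zb≡d , za<d)))

  module Block (j k : ℕ) (y : Word n) (y-inj : IsInjective y)
    (below : ∀ a → toℕ a < k → lookup y a F.≤ σ a (suc j))
    (avoids : ∀ c a → c F.< a → toℕ a < k → lookup y c ≢ σ a (suc j))
    (distinct : ∀ a a′ → toℕ a < k → toℕ a′ < k → σ a (suc j) ≡ σ a′ (suc j) → a ≡ a′) where

    d : Fin n → Fin n
    d a = σ a (suc j)

    cols : List (Fin n)
    cols = reverse (Cols n k)

    rows-of : List (Fin n) → List (Tagged n)
    rows-of R = concatMap (λ a → row-entries (suc j) a cols) R

    col∉ : ∀ {c} → toℕ c < k → c ∉ cols
    col∉ c<k c∈ =
      ℕP.<-irrefl refl (ℕP.<-≤-trans c<k (proj₂ (MP.∈-filter⁻ (λ b → k ℕ.≤? toℕ b) {xs = allFin n} (AnyP.reverse⁻ c∈))))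

    col∈ : ∀ {c} → k ≤ toℕ c → c ∈ cols
    col∈ k≤c = AnyP.reverse⁺ (MP.∈-filter⁺ (λ b → k ℕ.≤? toℕ b) (MP.∈-allFin _) k≤c)

    Filled : List (Fin n) → Set
    Filled R = (∀ c → c ∈ R → lookup (start y (rows-of R)) c ≡ d c)
             × (∀ c → toℕ c < k → c ∉ R → lookup (start y (rows-of R)) c ≡ lookup y c)

    UpClosed : List (Fin n) → Set
    UpClosed R = ∀ {c c′} → c ∈ R → c F.≤ c′ → toℕ c′ < k → c′ ∈ R

    value-in-columns : ∀ a R → toℕ a < k → All (a F.<_) R → UpClosed (a ∷ R) → Filled R →
      lookup y a F.< d a → Any (λ b → lookup (start y (rows-of R)) b ≡ d a) cols
    value-in-columns a R a<k R-above up (R-filled , rest-kept) ya<da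
      with injective⇒perm (start y (rows-of R)) (start-injective y (rows-of R) y-inj) (d a)
    ... | b , zb≡da with toℕ b ℕ.<? k
    ...   | no b≮k = Any.map (λ { refl → zb≡da }) (col∈ (ℕP.≮⇒≥ b≮k))
    ...   | yes b<k with FP.<-cmp b a
    ...     | tri< b<a _ _ = ⊥-elim (avoids b a b<a a<k (trans (sym (rest-kept b b<k b∉R)) zb≡da))
      where
      b∉R : b ∉ R
      b∉R b∈ = FP.<-asym b<a (All.lookup R-above b∈)
    ...     | tri≈ _ refl _ = ⊥-elim (FP.<-irrefl (trans (sym (rest-kept a a<k a∉R)) zb≡da) ya<da)
      where
      a∉R : a ∉ R
      a∉R a∈ = FP.<-irrefl refl (All.lookup R-above a∈)
    ...     | tri> _ _ a<b with up (here refl) (ℕP.<⇒≤ a<b) b<k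
    ...       | here b≡a = ⊥-elim (FP.<-irrefl (sym b≡a) a<b)
    ...       | there b∈R = ⊥-elim (FP.<-irrefl (distinct a b a<k b<k (trans (sym zb≡da) (R-filled b b∈R))) a<b)

    -- Rows are processed from the last one up, so a ∷ R means: R first, then the
    -- row of a, which is filled either already or from a column b ≥ k.
    fill-rows : ∀ R → AllPairs F._<_ R → All (λ a → toℕ a < k) R → UpClosed R → Filled R
    fill-rows [] _ _ _ = (λ c ()) , (λ c _ _ → refl)
    fill-rows (a ∷ R) (R-above ∷ sorted) (a<k ∷ R<k) up = filled , kept
      where
      a∉R : a ∉ R
      a∉R a∈ = FP.<-irrefl refl (All.lookup R-above a∈)
      up-R : UpClosed R
      up-R c∈ c≤c′ c′<k with up (there c∈) c≤c′ c′<k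
      ... | here refl = ⊥-elim (FP.<-irrefl refl (ℕP.<-≤-trans (All.lookup R-above c∈) c≤c′))
      ... | there c′∈ = c′∈
      IH = fill-rows R sorted R<k up-R
      z = start y (rows-of R)
      split : start y (rows-of (a ∷ R)) ≡ start z (row-entries (suc j) a cols)
      split = start-++ y (row-entries (suc j) a cols) (rows-of R)
      za≡ya : lookup z a ≡ lookup y a
      za≡ya = proj₂ IH a a<k a∉R
      open Row (suc j) a using (row-settled; row-fills; row-elsewhere)
      a-filled : lookup (start z (row-entries (suc j) a cols)) a ≡ d a
      a-filled with ℕP.m≤n⇒m<n∨m≡n (below a a<k)
      ... | inj₁ ya<da = row-fills z cols (subst (F._< d a) (sym za≡ya) ya<da) (value-in-columns a R a<k R-above up IH ya<da)
      ... | inj₂ ya≡da = trans (cong (λ v → lookup v a) (row-settled z cols za≡da)) za≡da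
        where
        za≡da : lookup z a ≡ d a
        za≡da = trans za≡ya (FP.toℕ-injective ya≡da)
      filled : ∀ c → c ∈ a ∷ R → lookup (start y (rows-of (a ∷ R))) c ≡ d c
      filled c (here refl) = trans (cong (λ v → lookup v c) split) a-filled
      filled c (there c∈) = trans (cong (λ v → lookup v c) split)
        (trans (row-elsewhere z cols c (λ { refl → a∉R c∈ }) (col∉ (All.lookup R<k c∈))) (proj₁ IH c c∈))
      kept : ∀ c → toℕ c < k → c ∉ a ∷ R → lookup (start y (rows-of (a ∷ R))) c ≡ lookup y c
      kept c c<k c∉ = trans (cong (λ v → lookup v c) split)
        (trans (row-elsewhere z cols c (λ c≡a → c∉ (here c≡a)) (col∉ c<k)) (proj₂ IH c c<k (λ c∈ → c∉ (there c∈))))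

    block-fills : ∀ c → toℕ c < k → lookup (start y (block-entries (suc j) k)) c ≡ d c
    block-fills c c<k = proj₁ (fill-rows (Rows n k) (APP.filter⁺ _ (APP.tabulate⁺-< {R = F._<_} (λ lt → lt)))
      (All.tabulate (λ c∈ → proj₂ (MP.∈-filter⁻ (λ a → suc (toℕ a) ℕ.≤? k) {xs = allFin n} c∈)))
      (λ {_} {c′} _ _ c′<k → MP.∈-filter⁺ (λ a → suc (toℕ a) ℕ.≤? k) (MP.∈-allFin c′) c′<k))
      c (MP.∈-filter⁺ (λ a → suc (toℕ a) ℕ.≤? k) (MP.∈-allFin c) c<k)

misses-value : {m : ℕ} (g : Fin m → Fin n) → m < n → ∃[ v ] (∀ i → g i ≢ v)
misses-value {n} {m} g m<n with FP.all? (λ v → FP.any? (λ i → g i F.≟ v))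
... | no ¬all-hit with FP.¬∀⟶∃¬ n _ (λ v → FP.any? (λ i → g i F.≟ v)) ¬all-hit
...   | v , not-hit = v , λ i gi≡v → not-hit (i , gi≡v)
misses-value {n} {m} g m<n | yes all-hit = ⊥-elim (ℕP.<⇒≱ m<n (FP.injective⇒≤ preimage-injective))
  where
  preimage : Fin n → Fin m
  preimage v = proj₁ (all-hit v)
  preimage-injective : Injective _≡_ _≡_ preimage
  preimage-injective {u} {v} eq = trans (sym (proj₂ (all-hit u))) (trans (cong g eq) (proj₂ (all-hit v)))

-- Parts of a partition with distinct parts, read at indices up to its length
-- (where the padding value 0 appears once), are pairwise different.
part-∈ : (p : List ℕ) (x : ℕ) → x < length p → part p x ∈ p
part-∈ (z ∷ p) zero _ = here refl
part-∈ (z ∷ p) (suc x) (s≤s x<len) = there (part-∈ p x x<len)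

part-beyond : (p : List ℕ) (x : ℕ) → length p ≤ x → part p x ≡ 0
part-beyond [] x _ = refl
part-beyond (z ∷ p) (suc x) (s≤s len≤x) = part-beyond p x len≤x

part-avoids : {z : ℕ} (p : List ℕ) (x : ℕ) → 1 ≤ z → All (z ≢_) p → x ≤ length p → z ≢ part p x
part-avoids p x 1≤z z∉p x≤len z≡part with ℕP.m≤n⇒m<n∨m≡n x≤len
... | inj₁ x<len = All.lookup z∉p (part-∈ p x x<len) z≡part
... | inj₂ refl = ℕP.<-irrefl (sym (trans z≡part (part-beyond p x ℕP.≤-refl))) 1≤z

part-injective : (p : List ℕ) → Unique p → All (1 ≤_) p →
  ∀ x y → x ≤ length p → y ≤ length p → part p x ≡ part p y → x ≡ y
part-injective [] _ _ zero zero _ _ _ = refl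
part-injective (z ∷ p) _ _ zero zero _ _ _ = refl
part-injective (z ∷ p) (z∉p ∷ _) (1≤z ∷ _) zero (suc y) _ (s≤s y≤len) eq = ⊥-elim (part-avoids p y 1≤z z∉p y≤len eq)
part-injective (z ∷ p) (z∉p ∷ _) (1≤z ∷ _) (suc x) zero (s≤s x≤len) _ eq = ⊥-elim (part-avoids p x 1≤z z∉p x≤len (sym eq))
part-injective (z ∷ p) (_ ∷ uniq) (_ ∷ pos) (suc x) (suc y) (s≤s x≤len) (s≤s y≤len) eq =
  cong suc (part-injective p uniq pos x y x≤len y≤len eq)

module Surjectivity (n′ : ℕ) (p : List ℕ) (p-part : IsPartition p) (p-distinct : Unique p) (p-len : length p ≡ n′)
                    (σ : Filling (suc n′)) (σ-in-F : InF p σ) where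
  open Greedy σ

  dec = partition-decreasing p-part
  columns = proj₁ σ-in-F
  attack = proj₁ (proj₂ σ-in-F)
  rows = proj₂ (proj₂ σ-in-F)

  conj-1 : conj p 1 ≡ n′
  conj-1 = trans (cong length (LP.filter-all (1 ℕ.≤?_) (proj₁ p-part))) p-len

  cell : ∀ (i : Fin (suc n′)) j → toℕ i < conj p (suc j) → Cell p i (suc j)
  cell i j i<conj = s≤s z≤n , conj⇒part p dec (suc j) (toℕ i) i<conj

  cell-1 : ∀ (i : Fin (suc n′)) → toℕ i < n′ → Cell p i 1
  cell-1 i i<n′ = cell i 0 (subst (toℕ i <_) (sym conj-1) i<n′)

  conj-shrinks : ∀ j (a : ℕ) → a < conj p (suc (suc j)) → a < conj p (suc j)
  conj-shrinks j a a<conj =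
    part⇒conj p dec (suc j) a (s≤s z≤n) (ℕP.≤-trans (ℕP.n≤1+n _) (conj⇒part p dec (suc (suc j)) a a<conj))

  missing : ∃[ v ] (∀ i → σ (F.inject₁ i) 1 ≢ v)
  missing = misses-value (λ i → σ (F.inject₁ i) 1) ℕP.≤-refl

  first-column : (i : Fin (suc n′)) → Dec (toℕ i < n′) → Fin (suc n′)
  first-column i (yes _) = σ i 1
  first-column i (no _) = proj₁ missing

  π₀ : Word (suc n′)
  π₀ = V.tabulate (λ i → first-column i (toℕ i ℕ.<? n′))

  π₀-top : ∀ i → toℕ i < n′ → lookup π₀ i ≡ σ i 1
  π₀-top i i<n′ with toℕ i ℕ.<? n′ | VP.lookup∘tabulate (λ i → first-column i (toℕ i ℕ.<? n′)) i
  ... | yes _ | eq = eq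
  ... | no i≮n′ | _ = ⊥-elim (i≮n′ i<n′)

  π₀-last : ∀ i → ¬ toℕ i < n′ → lookup π₀ i ≡ proj₁ missing
  π₀-last i i≮n′ with toℕ i ℕ.<? n′ | VP.lookup∘tabulate (λ i → first-column i (toℕ i ℕ.<? n′)) i
  ... | yes i<n′ | _ = ⊥-elim (i≮n′ i<n′)
  ... | no _ | eq = eq

  not-missing : ∀ i → toℕ i < n′ → σ i 1 ≢ proj₁ missing
  not-missing i i<n′ = subst (λ c → σ c 1 ≢ proj₁ missing) inject-back (proj₂ missing (F.fromℕ< i<n′))
    where
    inject-back : F.inject₁ (F.fromℕ< i<n′) ≡ i
    inject-back = FP.toℕ-injective (trans (FP.toℕ-inject₁ _) (FP.toℕ-fromℕ< i<n′))

  distinct : ∀ j a a′ → toℕ a < conj p (suc j) → toℕ a′ < conj p (suc j) → σ a (suc j) ≡ σ a′ (suc j) → a ≡ a′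
  distinct j a a′ a<k a′<k eq with a F.≟ a′
  ... | yes a≡a′ = a≡a′
  ... | no a≢a′ = ⊥-elim (columns a a′ (suc j) (cell a j a<k) (cell a′ j a′<k) a≢a′ eq)

  top-row : ∀ {i : Fin (suc n′)} → toℕ i < n′ → toℕ i < conj p 1
  top-row {i} = subst (toℕ i <_) (sym conj-1)

  π₀-injective : IsInjective π₀
  π₀-injective {i} {i′} eq with toℕ i ℕ.<? n′ | toℕ i′ ℕ.<? n′
  ... | yes i<n′ | yes i′<n′ =
    distinct 0 i i′ (top-row i<n′) (top-row i′<n′) (trans (sym (π₀-top i i<n′)) (trans eq (π₀-top i′ i′<n′)))
  ... | yes i<n′ | no i′≮n′ =
    ⊥-elim (not-missing i i<n′ (trans (sym (π₀-top i i<n′)) (trans eq (π₀-last i′ i′≮n′))))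
  ... | no i≮n′ | yes i′<n′ =
    ⊥-elim (not-missing i′ i′<n′ (trans (sym (π₀-top i′ i′<n′)) (trans (sym eq) (π₀-last i i≮n′))))
  ... | no i≮n′ | no i′≮n′ = FP.toℕ-injective (trans (last i i≮n′) (sym (last i′ i′≮n′)))
    where
    last : ∀ c → ¬ toℕ c < n′ → toℕ c ≡ n′
    last c c≮n′ = ℕP.≤-antisym (ℕP.≤-pred (FP.toℕ<n c)) (ℕP.≮⇒≥ c≮n′)

  π : ℕ → Word (suc n′)
  π j = start π₀ (Γ≤ (suc n′) p j)

  π-injective : ∀ j → IsInjective (π j)
  π-injective j = start-injective π₀ (Γ≤ (suc n′) p j) π₀-injective

  π-column : ∀ j i → toℕ i < conj p (suc j) → lookup (π (suc j)) i ≡ σ i (suc j)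
  π-column j i i<k = trans (cong (λ v → lookup v i) block-split)
    (Block.block-fills j (conj p (suc j)) (π j) (π-injective j) (below j) (avoids j) (distinct j) i i<k)
    where
    block-split : π (suc j) ≡ start (π j) (block-entries (suc j) (conj p (suc j)))
    block-split = trans (start-++ π₀ (Γblock (suc n′) p j) (Γ≤ (suc n′) p j)) (cong (start (π j)) (Γblock-entries p j))
    below : ∀ j a → toℕ a < conj p (suc j) → lookup (π j) a F.≤ σ a (suc j)
    below zero a a<k = ℕP.≤-reflexive (cong toℕ (π₀-top a (subst (toℕ a <_) conj-1 a<k)))
    below (suc j) a a<k = subst (λ v → v F.≤ σ a (suc (suc j))) (sym (π-column j a (conj-shrinks j (toℕ a) a<k)))
                            (rows a (suc j) (s≤s z≤n) (cell a (suc j) a<k))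
    avoids : ∀ j c a → c F.< a → toℕ a < conj p (suc j) → lookup (π j) c ≢ σ a (suc j)
    avoids zero c a c<a a<k eq = columns c a 1 (cell-1 c c<n′) (cell-1 a a<n′) (λ c≡a → FP.<-irrefl c≡a c<a)
                                   (trans (sym (π₀-top c c<n′)) eq)
      where
      a<n′ = subst (toℕ a <_) conj-1 a<k
      c<n′ = ℕP.<-trans c<a a<n′
    avoids (suc j) c a c<a a<k eq = attack a c (suc j) (cell a (suc j) a<k) (cell c j c<k) c<a
                                      (sym (trans (sym (π-column j c c<k)) eq))
      where
      c<k = ℕP.<-trans c<a (conj-shrinks j (toℕ a) a<k)

  w : Word (suc n′)
  w = start π₀ (Γ (suc n′) p)

  m : List Bool
  m = mask π₀ (Γ (suc n′) p)

  πj-reconstructed : ∀ j → j ≤ firstPart p → πj p w m j ≡ π j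
  πj-reconstructed j j≤λ₁ = from-head (Γ-split (suc n′) p j j≤λ₁)
    where
    open ≡-Reasoning
    Q = Γ≤ (suc n′) p j
    from-head : ∃[ P ] (Γ (suc n′) p ≡ P ++ Q) × All (λ e → suc j ≤ proj₁ e) P → πj p w m j ≡ π j
    from-head (P , Γ-eq , P-above) = begin
      πj p w m j                                          ≡⟨ cong (λ L → πj p w (mask π₀ L) j) Γ-eq ⟩
      πj p w (mask π₀ (P ++ Q)) j                         ≡⟨ cong (λ m → πj p w m j) (mask-++ π₀ P Q) ⟩
      πj p w (mask (π j) P ++ mask π₀ Q) j                ≡⟨ πj-prefix p w j P _ _ Γ-eq (mask-length (π j) P) P-above ⟩
      w ·* transps P (mask (π j) P)                       ≡⟨ cong (λ L → start π₀ L ·* transps P (mask (π j) P)) Γ-eq ⟩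
      start π₀ (P ++ Q) ·* transps P (mask (π j) P)       ≡⟨ cong (_·* transps P (mask (π j) P)) (start-++ π₀ P Q) ⟩
      start (π j) P ·* transps P (mask (π j) P)           ≡⟨ start-·* (π j) P ⟩
      π j                                                 ∎

  fill-correct : ∀ i j → Cell p i j → fill p w m i j ≡ σ i j
  fill-correct i zero (() , _)
  fill-correct i (suc j) (_ , j≤λᵢ) =
    trans (cong (λ v → lookup v i) (πj-reconstructed (suc j) (ℕP.≤-trans j≤λᵢ (part≤firstPart p dec (toℕ i)))))
          (π-column j i (part⇒conj p dec (suc j) (toℕ i) (s≤s z≤n) j≤λᵢ))

  -- W_λ is trivial (distinct parts, padded by a single 0), so w is minimal in its coset.
  w-minimal : IsMinRep p w
  w-minimal = injective⇒perm w w-injective , λ v _ v-stab → ℕP.≤-reflexive (cong len (sym (w∘v≡w v v-stab)))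
    where
    w-injective = start-injective π₀ (Γ (suc n′) p) π₀-injective
    index≤len : ∀ (x : Fin (suc n′)) → toℕ x ≤ length p
    index≤len x = subst (toℕ x ≤_) (sym p-len) (ℕP.≤-pred (FP.toℕ<n x))
    v-trivial : ∀ v → InStab p v → ∀ i → lookup v i ≡ i
    v-trivial v v-stab i =
      FP.toℕ-injective (part-injective p p-distinct (proj₁ p-part) _ _ (index≤len (lookup v i)) (index≤len i) (v-stab i))
    w∘v≡w : ∀ v → InStab p v → w ∘ₚ v ≡ w
    w∘v≡w v v-stab = word-ext λ i → trans (VP.lookup-map i (lookup w) v) (cong (lookup w) (v-trivial v v-stab i))

  w-in-A : InA p w m
  w-in-A = w-minimal , mask-length π₀ (Γ (suc n′) p) ,
           start-chain π₀ (Γ (suc n′) p) (All.map (λ (a<k , k≤b) → ℕP.<-≤-trans a<k k≤b) (Γ-straddles (suc n′) p))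

proposition3p7 : (n : ℕ) → 2 ≤ n → (p : List ℕ) → IsPartition p → length p ≤ n ∸ 1 →
    ((w : Word n) (m : List Bool) → InA p w m → InF p (fill p w m))
    × (Unique p → length p ≡ n ∸ 1 → (σ : Filling n) → InF p σ →
        Σ (Word n) (λ w → Σ (List Bool) (λ m →
          InA p w m × (∀ i j → Cell p i j → fill p w m i j ≡ σ i j))))
proposition3p7 zero () p _ _
proposition3p7 (suc n′) _ p p-part _ = fill-in-F p p-part , preimage
  where
  preimage : Unique p → length p ≡ n′ → (σ : Filling (suc n′)) → InF p σ →
    Σ (Word (suc n′)) (λ w → Σ (List Bool) (λ m → InA p w m × (∀ i j → Cell p i j → fill p w m i j ≡ σ i j)))
  preimage p-distinct p-len σ σ-in-F = w , m , w-in-A , fill-correct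
    where open Surjectivity n′ p p-part p-distinct p-len σ σ-in-F
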